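{- For every formula $\varphi\in\mathcal{L}$: if $\vdash\varphi$, then $\models\varphi$.
   Context: Fix a countable set $\mathcal{AP}$ of atomic propositions. A weighted transition system (WTS) is a triple $\mathcal{M}=(S,\rightarrow,\ell)$ where $S$ is a non-empty set of states, $\rightarrow\subseteq S\times\mathbb{R}_{\ge 0}\times S$ is a transition relation (write $s\xrightarrow{r}t$), and $\ell:S\to 2^{\mathcal{AP}}$ is a labeling. For $s\in S$, $T\subseteq S$ let $\theta(s)(T)=\{r\mid \exists t\in T,\ s\xrightarrow{r}t\}$; $\theta^-(s)(T)=-\infty$ if $\theta(s)(T)=\emptyset$, else $\inf\theta(s)(T)$; $\theta^+(s)(T)=\infty$ if $\theta(s)(T)=\emptyset$, else $\sup\theta(s)(T)$. Formulae of $\mathcal{L}$: $\varphi::= p\mid\neg\varphi\mid\varphi\wedge\varphi\mid L_r\varphi\mid M_r\varphi$ with $p\in\mathcal{AP}$, $r\in\mathbb{Q}_{\ge0}$; $\bot,\vee,\to,\leftrightarrow$ defined as usual. Semantics: $\mathcal{M},s\models p$ iff $p\in\ell(s)$; Boolean cases as usual; $\mathcal{M},s\models L_r\varphi$ iff $\theta^-(s)([\![\varphi]\!])\ge r$; $\mathcal{M},s\models M_r\varphi$ iff $\theta^+(s)([\![\varphi]\!])\le r$, where $[\![\varphi]\!]$ is the set of states satisfying $\varphi$. $\models\varphi$ means $\neg\varphi$ is not satisfiable, i.e. $\varphi$ holds at every state of every WTS. Axiomatic system: $\vdash\varphi$ means $\varphi$ belongs to the smallest set of formulae containing all instances of propositional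 tautologies and of the axioms below, closed under modus ponens and the rules below (all $r,q\in\mathbb{Q}_{\ge0}$): (A1) $\neg L_0\bot$; (A2) $L_{r+q}\varphi\to L_r\varphi$ if $q>0$; (A2$'$) $M_r\varphi\to M_{r+q}\varphi$ if $q>0$; (A3) $L_r\varphi\wedge L_q\psi\to L_{\min\{r,q\}}(\varphi\vee\psi)$; (A3$'$) $M_r\varphi\wedge M_q\psi\to M_{\max\{r,q\}}(\varphi\vee\psi)$; (A4) $L_r(\varphi\vee\psi)\to L_r\varphi\vee L_r\psi$; (A5) $\neg L_0\psi\to(L_r\varphi\to L_r(\varphi\vee\psi))$; (A5$'$) $\neg L_0\psi\to(M_r\varphi\to M_r(\varphi\vee\psi))$; (A6) $L_{r+q}\varphi\to\neg M_r\varphi$ if $q>0$; (A7) $M_r\varphi\to L_0\varphi$; (R1) from $\vdash\varphi\to\psi$ infer $\vdash(L_r\psi\wedge L_0\varphi)\to L_r\varphi$; (R1$'$) from $\vdash\varphi\to\psi$ infer $\vdash(M_r\psi\wedge L_0\varphi)\to M_r\varphi$; (R2) from $\vdash\varphi\to\psi$ infer $\vdash L_0\varphi\to L_0\psi$. -}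

module Defs where

open import Data.Nat using (ℕ)
open import Level using (Lift) renaming (suc to lsuc; zero to 0ℓ)
open import Data.Bool using (Bool; true; false; not; _∧_)
open import Data.Product using (Σ; ∃; _×_; _,_)
open import Data.Sum using (_⊎_)
open import Data.Empty using (⊥)
open import Relation.Nullary using (¬_)
open import Relation.Binary.PropositionalEquality using (_≡_)
open import Data.Rational using (ℚ; 0ℚ; _+_; _⊓_; _⊔_)
  renaming (_≤_ to _≤ℚ_; _<_ to _<ℚ_)
open import Data.Rational.Properties using (⊓-glb; p≤p⊔q; ≤-trans; +-mono-≤)

record ℚ≥0 : Set where
  constructor mkℚ≥0
  field
    val    : ℚ
    nonneg : 0ℚ ≤ℚ val
open ℚ≥0 public

zeroQ : ℚ≥0
zeroQ = mkℚ≥0 0ℚ (Data.Rational.Properties.≤-refl)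

_+Q_ : ℚ≥0 → ℚ≥0 → ℚ≥0
mkℚ≥0 r p +Q mkℚ≥0 q p' = mkℚ≥0 (r + q) (+-mono-≤ p p')

minQ : ℚ≥0 → ℚ≥0 → ℚ≥0
minQ (mkℚ≥0 r p) (mkℚ≥0 q p') = mkℚ≥0 (r ⊓ q) (⊓-glb p p')

maxQ : ℚ≥0 → ℚ≥0 → ℚ≥0
maxQ (mkℚ≥0 r p) (mkℚ≥0 q p') = mkℚ≥0 (r ⊔ q) (≤-trans p (p≤p⊔q r q))

-- Non-negative real numbers as (two-sided) Dedekind cuts of ℚ.
-- lower q  means  q < x ;  upper q  means  x < q.

record ℝ≥0 : Set₁ where
  field
    lower     : ℚ → Set
    upper     : ℚ → Set
    inhabitedL : ∃ λ q → lower q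
    inhabitedU : ∃ λ q → upper q
    roundedL₁ : ∀ q → lower q → ∃ λ r → (q <ℚ r) × lower r
    roundedL₂ : ∀ q r → q <ℚ r → lower r → lower q
    roundedU₁ : ∀ q → upper q → ∃ λ r → (r <ℚ q) × upper r
    roundedU₂ : ∀ q r → q <ℚ r → upper q → upper r
    disjoint  : ∀ q → ¬ (lower q × upper q)
    located   : ∀ q r → q <ℚ r → lower q ⊎ upper r
    nonneg    : ¬ upper 0ℚ
open ℝ≥0 public

_≤ᴿ_ : ℚ → ℝ≥0 → Set
q ≤ᴿ x = ¬ upper x q

_ᴿ≤_ : ℝ≥0 → ℚ → Set
x ᴿ≤ q = ¬ lower x q

data Form : Set where
  atom : ℕ → Form
  neg  : Form → Form
  and  : Form → Form → Form
  L    : ℚ≥0 → Form → Form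
  M    : ℚ≥0 → Form → Form

bot : Form
bot = and (atom 0) (neg (atom 0))

_or_ : Form → Form → Form
φ or ψ = neg (and (neg φ) (neg ψ))

_imp_ : Form → Form → Form
φ imp ψ = neg (and φ (neg ψ))

-- Propositional tautologies: true under every Boolean valuation of the
-- non-Boolean subformulae (atoms and modal formulae).
evalB : (Form → Bool) → Form → Bool
evalB v (atom p)  = v (atom p)
evalB v (neg φ)   = not (evalB v φ)
evalB v (and φ ψ) = evalB v φ ∧ evalB v ψ
evalB v (L r φ)   = v (L r φ)
evalB v (M r φ)   = v (M r φ)

Tautology : Form → Set
Tautology φ = ∀ (v : Form → Bool) → evalB v φ ≡ true

Pos : ℚ≥0 → Set
Pos q = 0ℚ <ℚ val q

data ⊢_ : Form → Set where
  taut : ∀ {φ} → Tautology φ → ⊢ φ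
  A1   : ⊢ neg (L zeroQ bot)
  A2   : ∀ φ r q → Pos q → ⊢ (L (r +Q q) φ imp L r φ)
  A2'  : ∀ φ r q → Pos q → ⊢ (M r φ imp M (r +Q q) φ)
  A3   : ∀ φ ψ r q → ⊢ (and (L r φ) (L q ψ) imp L (minQ r q) (φ or ψ))
  A3'  : ∀ φ ψ r q → ⊢ (and (M r φ) (M q ψ) imp M (maxQ r q) (φ or ψ))
  A4   : ∀ φ ψ r → ⊢ (L r (φ or ψ) imp (L r φ or L r ψ))
  A5   : ∀ φ ψ r → ⊢ (neg (L zeroQ ψ) imp (L r φ imp L r (φ or ψ)))
  A5'  : ∀ φ ψ r → ⊢ (neg (L zeroQ ψ) imp (M r φ imp M r (φ or ψ)))
  A6   : ∀ φ r q → Pos q → ⊢ (L (r +Q q) φ imp neg (M r φ))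
  A7   : ∀ φ r → ⊢ (M r φ imp L zeroQ φ)
  MP   : ∀ {φ ψ} → ⊢ φ → ⊢ (φ imp ψ) → ⊢ ψ
  R1   : ∀ {φ ψ} r → ⊢ (φ imp ψ) → ⊢ (and (L r ψ) (L zeroQ φ) imp L r φ)
  R1'  : ∀ {φ ψ} r → ⊢ (φ imp ψ) → ⊢ (and (M r ψ) (L zeroQ φ) imp M r φ)
  R2   : ∀ {φ ψ} → ⊢ (φ imp ψ) → ⊢ (L zeroQ φ imp L zeroQ ψ)

record WTS : Set₂ where
  field
    State    : Set
    inhabited : State
    _⟶[_]_   : State → ℝ≥0 → State → Set
    label    : State → ℕ → Set
open WTS public

θ : (𝓜 : WTS) → State 𝓜 → (State 𝓜 → Set₁) → ℝ≥0 → Set₁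
θ 𝓜 s T w = Σ (State 𝓜) λ t → T t × _⟶[_]_ 𝓜 s w t

-- θ⁻(s)(T) ≥ r : θ(s)(T) ≠ ∅ (else θ⁻ = -∞) and r is a lower bound of it
InfGeq : (𝓜 : WTS) → State 𝓜 → (State 𝓜 → Set₁) → ℚ → Set₁
InfGeq 𝓜 s T r = (∃ λ w → θ 𝓜 s T w) × (∀ w → θ 𝓜 s T w → r ≤ᴿ w)

-- θ⁺(s)(T) ≤ r : θ(s)(T) ≠ ∅ (else θ⁺ = ∞) and r is an upper bound of it
SupLeq : (𝓜 : WTS) → State 𝓜 → (State 𝓜 → Set₁) → ℚ → Set₁
SupLeq 𝓜 s T r = (∃ λ w → θ 𝓜 s T w) × (∀ w → θ 𝓜 s T w → w ᴿ≤ r)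

_,_⊨_ : (𝓜 : WTS) → State 𝓜 → Form → Set₁
𝓜 , s ⊨ atom p  = Lift (lsuc 0ℓ) (label 𝓜 s p)
𝓜 , s ⊨ neg φ   = ¬ (𝓜 , s ⊨ φ)
𝓜 , s ⊨ and φ ψ = (𝓜 , s ⊨ φ) × (𝓜 , s ⊨ ψ)
𝓜 , s ⊨ L r φ   = InfGeq 𝓜 s (λ t → 𝓜 , t ⊨ φ) (val r)
𝓜 , s ⊨ M r φ   = SupLeq 𝓜 s (λ t → 𝓜 , t ⊨ φ) (val r)

Valid : Form → Set₂
Valid φ = ∀ (𝓜 : WTS) → ¬ (Σ (State 𝓜) λ s → 𝓜 , s ⊨ neg φ)

-- Validity is the negative statement "¬φ is not satisfiable", so it
-- suffices to show that every theorem is ¬¬-true at every state of every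
-- WTS; working under ¬¬ gives us excluded middle for finitely many
-- propositions at a time, which is all the classical reasoning we need.
module Submission where

open import Defs
open import Level using () renaming (suc to lsuc; zero to 0ℓ)
open import Data.Bool using (Bool; true; false; not; T)
open import Data.Bool.Properties using (T-≡; T-∧)
open import Data.Unit using (tt)
open import Data.Product using (∃; _×_; _,_; proj₁)
open import Data.Product.Function.NonDependent.Propositional using (_×-⇔_)
open import Data.Sum using ([_,_]′)
open import Data.List using (List; []; _∷_; _++_)
open import Data.List.Relation.Unary.All using (All; []; _∷_)
open import Data.List.Relation.Unary.Any using (here; tail)
open import Data.List.Membership.Propositional using (_∈_)
open import Data.List.Membership.Propositional.Properties using (∈-++⁺ˡ; ∈-++⁺ʳ)
import Data.Nat as ℕ
open import Function using (_∘_; const)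
open import Function.Bundles using (_⇔_; mk⇔; Equivalence)
open import Function.Properties.Equivalence using () renaming (trans to ⇔-trans)
open import Function.Related.TypeIsomorphisms using (¬-cong-⇔)
open import Effect.Monad using (RawMonad)
open import Relation.Nullary using (¬_; Dec; yes; no; isYes)
open import Relation.Nullary.Negation using (¬¬-Monad; ¬¬-map)
open import Relation.Nullary.Decidable using (¬¬-excluded-middle)
open import Relation.Binary.PropositionalEquality using (_≡_; refl; cong; subst)
open import Data.Rational using (ℚ; 0ℚ; _+_; _⊓_; _⊔_)
  renaming (_≤_ to _≤ℚ_; _<_ to _<ℚ_)
import Data.Rational.Properties as ℚP

-- All propositions we reason about classically live in Set₁.
open RawMonad (¬¬-Monad {lsuc 0ℓ}) using (pure; _>>=_)

r≤r+q : ∀ (r : ℚ) {q} → 0ℚ ≤ℚ q → r ≤ℚ r + q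
r≤r+q r 0≤q = subst (_≤ℚ r + _) (ℚP.+-identityʳ r) (ℚP.+-monoʳ-≤ r 0≤q)

r<r+q : ∀ (r : ℚ) {q} → 0ℚ <ℚ q → r <ℚ r + q
r<r+q r 0<q = subst (_<ℚ r + _) (ℚP.+-identityʳ r) (ℚP.+-monoʳ-< r 0<q)

upper-mono : ∀ (w : ℝ≥0) {q r} → q ≤ℚ r → upper w q → upper w r
upper-mono w {q} {r} q≤r w<q with roundedU₁ w q w<q
... | q' , q'<q , w<q' = roundedU₂ w q' r (ℚP.<-≤-trans q'<q q≤r) w<q'

lower-mono : ∀ (w : ℝ≥0) {q r} → q ≤ℚ r → lower w r → lower w q
lower-mono w {q} {r} q≤r r<w with roundedL₁ w r r<w
... | r' , r<r' , r'<w = roundedL₂ w q r' (ℚP.≤-<-trans q≤r r<r') r'<w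

-- Decidable equality of formulae, needed to build valuations from
-- finitely many decisions

ℚ≥0-≡ : ∀ {a b : ℚ≥0} → val a ≡ val b → a ≡ b
ℚ≥0-≡ {mkℚ≥0 v p} {mkℚ≥0 .v p'} refl = cong (mkℚ≥0 v) (ℚP.≤-irrelevant p p')

_≟Q_ : (a b : ℚ≥0) → Dec (a ≡ b)
a ≟Q b with val a ℚP.≟ val b
... | yes e = yes (ℚ≥0-≡ e)
... | no ne = no (ne ∘ cong val)

_≟F_ : (a b : Form) → Dec (a ≡ b)
atom p ≟F atom q with p ℕ.≟ q
... | yes refl = yes refl
... | no ne = no λ { refl → ne refl }
neg a ≟F neg b with a ≟F b
... | yes refl = yes refl
... | no ne = no λ { refl → ne refl }
and a a' ≟F and b b' with a ≟F b | a' ≟F b'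
... | yes refl | yes refl = yes refl
... | no ne | _ = no λ { refl → ne refl }
... | _ | no ne = no λ { refl → ne refl }
L r a ≟F L q b with r ≟Q q | a ≟F b
... | yes refl | yes refl = yes refl
... | no ne | _ = no λ { refl → ne refl }
... | _ | no ne = no λ { refl → ne refl }
M r a ≟F M q b with r ≟Q q | a ≟F b
... | yes refl | yes refl = yes refl
... | no ne | _ = no λ { refl → ne refl }
... | _ | no ne = no λ { refl → ne refl }
atom _ ≟F neg _ = no λ ()
atom _ ≟F and _ _ = no λ ()
atom _ ≟F L _ _ = no λ ()
atom _ ≟F M _ _ = no λ ()
neg _ ≟F atom _ = no λ ()
neg _ ≟F and _ _ = no λ ()
neg _ ≟F L _ _ = no λ ()
neg _ ≟F M _ _ = no λ ()
and _ _ ≟F atom _ = no λ ()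
and _ _ ≟F neg _ = no λ ()
and _ _ ≟F L _ _ = no λ ()
and _ _ ≟F M _ _ = no λ ()
L _ _ ≟F atom _ = no λ ()
L _ _ ≟F neg _ = no λ ()
L _ _ ≟F and _ _ = no λ ()
L _ _ ≟F M _ _ = no λ ()
M _ _ ≟F atom _ = no λ ()
M _ _ ≟F neg _ = no λ ()
M _ _ ≟F and _ _ = no λ ()
M _ _ ≟F L _ _ = no λ ()

T-not : ∀ {b} → T (not b) ⇔ (¬ T b)
T-not {true} = mk⇔ (λ ()) (λ ¬t → ¬t tt)
T-not {false} = mk⇔ (λ _ ()) (const tt)

T-isYes : ∀ {A : Set₁} (d : Dec A) → T (isYes d) ⇔ A
T-isYes (yes a) = mk⇔ (const a) (const tt)
T-isYes (no ¬a) = mk⇔ (λ ()) ¬a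

module _ {P : Form → Set₁} where

  decide-all : ∀ as → ¬ ¬ All (λ a → Dec (P a)) as
  decide-all [] = pure []
  decide-all (a ∷ as) = ¬¬-excluded-middle >>= λ d →
                        decide-all as >>= λ ds → pure (d ∷ ds)

  valuation : ∀ {as} → All (λ a → Dec (P a)) as → Form → Bool
  valuation [] x = false
  valuation {a ∷ _} (d ∷ ds) x with x ≟F a
  ... | yes _ = isYes d
  ... | no _ = valuation ds x

  valuation-agrees : ∀ {as} (ds : All (λ a → Dec (P a)) as) {x} →
                     x ∈ as → T (valuation ds x) ⇔ P x
  valuation-agrees {a ∷ _} (d ∷ ds) {x} x∈ with x ≟F a
  ... | yes refl = T-isYes d
  ... | no x≢a = valuation-agrees ds (tail x≢a x∈)

-- The subformulae that evalB treats as propositional variables.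
atoms : Form → List Form
atoms (atom p) = atom p ∷ []
atoms (neg φ) = atoms φ
atoms (and φ ψ) = atoms φ ++ atoms ψ
atoms (L r φ) = L r φ ∷ []
atoms (M r φ) = M r φ ∷ []

module _ (𝓜 : WTS) (s : State 𝓜) where

  evaluation : ∀ (v : Form → Bool) φ → (∀ {a} → a ∈ atoms φ → T (v a) ⇔ (𝓜 , s ⊨ a)) →
               T (evalB v φ) ⇔ (𝓜 , s ⊨ φ)
  evaluation v (atom p) agree = agree (here refl)
  evaluation v (L r φ) agree = agree (here refl)
  evaluation v (M r φ) agree = agree (here refl)
  evaluation v (neg φ) agree = ⇔-trans T-not (¬-cong-⇔ (evaluation v φ agree))
  evaluation v (and φ ψ) agree =
    ⇔-trans T-∧ (evaluation v φ (agree ∘ ∈-++⁺ˡ)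
                 ×-⇔ evaluation v ψ (agree ∘ ∈-++⁺ʳ (atoms φ)))

  tautology-¬¬-true : ∀ φ → Tautology φ → ¬ ¬ (𝓜 , s ⊨ φ)
  tautology-¬¬-true φ is-taut = ¬¬-map true-under (decide-all (atoms φ))
    where
    true-under : All (λ a → Dec (𝓜 , s ⊨ a)) (atoms φ) → 𝓜 , s ⊨ φ
    true-under ds = Equivalence.to (evaluation (valuation ds) φ (valuation-agrees ds))
                                   (Equivalence.from T-≡ (is-taut (valuation ds)))

_∪_ : ∀ {A : Set} → (A → Set₁) → (A → Set₁) → A → Set₁
(P ∪ Q) x = ¬ (¬ P x × ¬ Q x)

∪-introˡ : ∀ {A : Set} {P Q : A → Set₁} {x} → P x → (P ∪ Q) x
∪-introˡ p (¬p , _) = ¬p p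

∪-introʳ : ∀ {A : Set} {P Q : A → Set₁} {x} → Q x → (P ∪ Q) x
∪-introʳ q (_ , ¬q) = ¬q q

_⊆¬¬_ : ∀ {A : Set} → (A → Set₁) → (A → Set₁) → Set₁
P ⊆¬¬ Q = ∀ x → P x → ¬ ¬ Q x

module Successors {𝓜 : WTS} {s : State 𝓜} where

  Succ : (State 𝓜 → Set₁) → Set₁
  Succ T = ∃ λ w → θ 𝓜 s T w

  -- With
  -- X = (· < r) and X = (r < ·) these are the bound halves of InfGeq and
  -- SupLeq, so  InfGeq T r = Succ T × Avoids T (λ w → upper w r).
  Avoids : (State 𝓜 → Set₁) → (ℝ≥0 → Set) → Set₁
  Avoids T X = ∀ w → θ 𝓜 s T w → ¬ X w

  θ-⊆ : ∀ {T U : State 𝓜 → Set₁} {w} → (∀ {t} → T t → U t) → θ 𝓜 s T w → θ 𝓜 s U w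
  θ-⊆ T⊆U (t , x , tr) = t , T⊆U x , tr

  avoids-region : ∀ {T X Y} → (∀ w → X w → Y w) → Avoids T Y → Avoids T X
  avoids-region X⊆Y a w th = a w th ∘ X⊆Y w

  -- Avoidance is a negative statement, so ¬¬-inclusion suffices.
  avoids-restrict : ∀ {T U X} → T ⊆¬¬ U → Avoids U X → Avoids T X
  avoids-restrict T⊆U a w (t , x , tr) xw = T⊆U t x λ y → a w (t , y , tr) xw

  avoids-∪ : ∀ {T U X} → Avoids T X → Avoids U X → Avoids (T ∪ U) X
  avoids-∪ a b w (t , o , tr) xw = o ((λ x → a w (t , x , tr) xw) , (λ y → b w (t , y , tr) xw))

  succ-∪ˡ : ∀ {T U} → Succ T → Succ (T ∪ U)
  succ-∪ˡ {T} {U} (w , th) = w , θ-⊆ (∪-introˡ {P = T} {Q = U}) th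

  avoids-∪⁻ˡ : ∀ {T U X} → Avoids (T ∪ U) X → Avoids T X
  avoids-∪⁻ˡ {T} {U} = avoids-restrict λ _ x → pure (∪-introˡ {P = T} {Q = U} x)

  avoids-∪⁻ʳ : ∀ {T U X} → Avoids (T ∪ U) X → Avoids U X
  avoids-∪⁻ʳ {T} {U} = avoids-restrict λ _ y → pure (∪-introʳ {P = T} {Q = U} y)

  -- Weights are non-negative, so θ⁻(s)(T) ≥ 0 just says θ(s)(T) ≠ ∅.
  succ⇒inf0 : ∀ {T} → Succ T → InfGeq 𝓜 s T 0ℚ
  succ⇒inf0 ex = ex , λ w _ → nonneg w

  inf-empty : ∀ {T r} → (∀ t → ¬ T t) → ¬ InfGeq 𝓜 s T r
  inf-empty empty ((_ , t , x , _) , _) = empty t x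

  unreachable-avoids : ∀ {T X} → ¬ InfGeq 𝓜 s T 0ℚ → Avoids T X
  unreachable-avoids ¬T0 w th _ = ¬T0 (succ⇒inf0 (w , th))

  inf-antitone : ∀ {T q r} → q ≤ℚ r → InfGeq 𝓜 s T r → InfGeq 𝓜 s T q
  inf-antitone q≤r (ex , a) = ex , avoids-region (λ w → upper-mono w q≤r) a

  sup-monotone : ∀ {T q r} → r ≤ℚ q → SupLeq 𝓜 s T r → SupLeq 𝓜 s T q
  sup-monotone r≤q (ex , a) = ex , avoids-region (λ w → lower-mono w r≤q) a

  inf-∪ : ∀ {T U r q} → InfGeq 𝓜 s T r → InfGeq 𝓜 s U q → InfGeq 𝓜 s (T ∪ U) (r ⊓ q)
  inf-∪ {r = r} {q} (ex , a) (_ , b) =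
    succ-∪ˡ ex ,
    avoids-∪ (avoids-region (λ w → upper-mono w (ℚP.p⊓q≤p r q)) a)
             (avoids-region (λ w → upper-mono w (ℚP.p⊓q≤q r q)) b)

  sup-∪ : ∀ {T U r q} → SupLeq 𝓜 s T r → SupLeq 𝓜 s U q → SupLeq 𝓜 s (T ∪ U) (r ⊔ q)
  sup-∪ {r = r} {q} (ex , a) (_ , b) =
    succ-∪ˡ ex ,
    avoids-∪ (avoids-region (λ w → lower-mono w (ℚP.p≤p⊔q r q)) a)
             (avoids-region (λ w → lower-mono w (ℚP.p≤q⊔p r q)) b)

  -- (A4): a lower bound for a union is a lower bound for one of the sets,
  -- namely for the one containing a witness successor.
  inf-∪-split : ∀ {T U r} → InfGeq 𝓜 s (T ∪ U) r →
                ¬ (¬ InfGeq 𝓜 s T r × ¬ InfGeq 𝓜 s U r)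
  inf-∪-split ((w , t , o , tr) , a) (¬T , ¬U) =
    o ((λ x → ¬T ((w , t , x , tr) , avoids-∪⁻ˡ a)) ,
       (λ y → ¬U ((w , t , y , tr) , avoids-∪⁻ʳ a)))

  inf-∪-unreachable : ∀ {T U r} → ¬ InfGeq 𝓜 s U 0ℚ → InfGeq 𝓜 s T r → InfGeq 𝓜 s (T ∪ U) r
  inf-∪-unreachable ¬U0 (ex , a) = succ-∪ˡ ex , avoids-∪ a (unreachable-avoids ¬U0)

  sup-∪-unreachable : ∀ {T U r} → ¬ InfGeq 𝓜 s U 0ℚ → SupLeq 𝓜 s T r → SupLeq 𝓜 s (T ∪ U) r
  sup-∪-unreachable ¬U0 (ex , a) = succ-∪ˡ ex , avoids-∪ a (unreachable-avoids ¬U0)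

  -- (A6): θ⁻ ≥ q and θ⁺ ≤ r are incompatible when r < q, by locatedness
  -- of any single weight in θ(s)(T).
  inf-sup-disjoint : ∀ {T r q} → r <ℚ q → InfGeq 𝓜 s T q → ¬ SupLeq 𝓜 s T r
  inf-sup-disjoint {r = r} {q} r<q ((w , th) , a) (_ , b) =
    [ b w th , a w th ]′ (located w r q r<q)

  sup⇒inf0 : ∀ {T r} → SupLeq 𝓜 s T r → InfGeq 𝓜 s T 0ℚ
  sup⇒inf0 = succ⇒inf0 ∘ proj₁

  inf-restrict : ∀ {T U r} → T ⊆¬¬ U → InfGeq 𝓜 s U r → InfGeq 𝓜 s T 0ℚ → InfGeq 𝓜 s T r
  inf-restrict T⊆U (_ , a) (ex , _) = ex , avoids-restrict T⊆U a

  sup-restrict : ∀ {T U r} → T ⊆¬¬ U → SupLeq 𝓜 s U r → InfGeq 𝓜 s T 0ℚ → SupLeq 𝓜 s T r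
  sup-restrict T⊆U (_ , a) (ex , _) = ex , avoids-restrict T⊆U a

  inf0-mono : ∀ {T U} → T ⊆¬¬ U → InfGeq 𝓜 s T 0ℚ → ¬ ¬ InfGeq 𝓜 s U 0ℚ
  inf0-mono T⊆U ((w , t , x , tr) , _) = ¬¬-map (λ y → succ⇒inf0 (w , t , y , tr)) (T⊆U t x)

module Soundness (𝓜 : WTS) where
  open Successors {𝓜}

  Sound : Form → Set₁
  Sound φ = ∀ s → ¬ ¬ (𝓜 , s ⊨ φ)

  ⟦_⟧ : Form → State 𝓜 → Set₁
  ⟦ φ ⟧ t = 𝓜 , t ⊨ φ

  -- φ imp ψ is interpreted as ¬(φ ∧ ¬ψ), a negative formula.
  ⇒-intro : ∀ {s} φ ψ → (𝓜 , s ⊨ φ → 𝓜 , s ⊨ ψ) → 𝓜 , s ⊨ (φ imp ψ)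
  ⇒-intro φ ψ f (x , ¬y) = ¬y (f x)

  ⇒-intro¬¬ : ∀ {s} φ ψ → (𝓜 , s ⊨ φ → ¬ ¬ (𝓜 , s ⊨ ψ)) → 𝓜 , s ⊨ (φ imp ψ)
  ⇒-intro¬¬ φ ψ f (x , ¬y) = f x ¬y

  ⇒-elim : ∀ {s} φ ψ → ¬ ¬ (𝓜 , s ⊨ (φ imp ψ)) → 𝓜 , s ⊨ φ → ¬ ¬ (𝓜 , s ⊨ ψ)
  ⇒-elim φ ψ i x ¬y = i λ f → f (x , ¬y)

  sound⇒⊆¬¬ : ∀ {φ ψ} → Sound (φ imp ψ) → ⟦ φ ⟧ ⊆¬¬ ⟦ ψ ⟧
  sound⇒⊆¬¬ {φ} {ψ} d t = ⇒-elim φ ψ (d t)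

  -- The axioms A1-A7 and the conclusions of R1, R1' are true outright;
  -- tautologies, modus ponens and R2 genuinely need the ¬¬.
  sound : ∀ {φ} → ⊢ φ → Sound φ
  sound (taut {φ} t) s = tautology-¬¬-true 𝓜 s φ t
  sound A1 s = pure (inf-empty λ _ (x , ¬x) → ¬x x)
  sound (A2 φ r q _) s = pure (⇒-intro (L (r +Q q) φ) (L r φ)
    (inf-antitone (r≤r+q (val r) (nonneg q))))
  sound (A2' φ r q _) s = pure (⇒-intro (M r φ) (M (r +Q q) φ)
    (sup-monotone (r≤r+q (val r) (nonneg q))))
  sound (A3 φ ψ r q) s = pure (⇒-intro (and (L r φ) (L q ψ)) (L (minQ r q) (φ or ψ))
    λ (Lφ , Lψ) → inf-∪ Lφ Lψ)
  sound (A3' φ ψ r q) s = pure (⇒-intro (and (M r φ) (M q ψ)) (M (maxQ r q) (φ or ψ))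
    λ (Mφ , Mψ) → sup-∪ Mφ Mψ)
  sound (A4 φ ψ r) s = pure (⇒-intro (L r (φ or ψ)) (L r φ or L r ψ) inf-∪-split)
  sound (A5 φ ψ r) s = pure (⇒-intro (neg (L zeroQ ψ)) (L r φ imp L r (φ or ψ))
    λ ¬L0ψ → ⇒-intro (L r φ) (L r (φ or ψ)) (inf-∪-unreachable ¬L0ψ))
  sound (A5' φ ψ r) s = pure (⇒-intro (neg (L zeroQ ψ)) (M r φ imp M r (φ or ψ))
    λ ¬L0ψ → ⇒-intro (M r φ) (M r (φ or ψ)) (sup-∪-unreachable ¬L0ψ))
  sound (A6 φ r q q>0) s = pure (⇒-intro (L (r +Q q) φ) (neg (M r φ))
    (inf-sup-disjoint (r<r+q (val r) q>0)))
  sound (A7 φ r) s = pure (⇒-intro (M r φ) (L zeroQ φ) sup⇒inf0)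
  sound (MP {φ} {ψ} d e) s = sound d s >>= ⇒-elim φ ψ (sound e s)
  sound (R1 {φ} {ψ} r d) s = pure (⇒-intro (and (L r ψ) (L zeroQ φ)) (L r φ)
    λ (Lψ , L0φ) → inf-restrict (sound⇒⊆¬¬ (sound d)) Lψ L0φ)
  sound (R1' {φ} {ψ} r d) s = pure (⇒-intro (and (M r ψ) (L zeroQ φ)) (M r φ)
    λ (Mψ , L0φ) → sup-restrict (sound⇒⊆¬¬ (sound d)) Mψ L0φ)
  sound (R2 {φ} {ψ} d) s = pure (⇒-intro¬¬ (L zeroQ φ) (L zeroQ ψ)
    (inf0-mono (sound⇒⊆¬¬ (sound d))))

theorem4p2 : ∀ (φ : Form) → ⊢ φ → Valid φ
theorem4p2 φ d 𝓜 (s , ¬φ) = Soundness.sound 𝓜 d s ¬φ
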